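{- Let $k\geq 4$ and let $G$ be a $k$-gate. Then $G$ belongs to Helly $[k,2,2]$. Furthermore, $G$ admits a Helly $(k,2,2)$-representation on a host tree that is a star.
   Context: All graphs are finite and simple; a clique is a maximal (under inclusion) set of pairwise adjacent vertices. Gates are defined recursively: (i) every chordless cycle $C_n$ with $n\geq 4$ is a gate; (ii) if $G$ is a gate, $C$ and $C'$ are vertex-disjoint cliques of $G$, and $P=(v_1,\dots,v_l)$ with $l\geq 2$ is a chordless path vertex-disjoint from $G$, then the graph formed by the union of $G$ and $P$ together with all edges between $v_1$ and the vertices of $C$ and all edges between $v_l$ and the vertices of $C'$ is a gate; (iii) there are no other gates. A gate with exactly $k$ cliques is a $k$-gate. An EPT representation of a graph $G$ is a pair $\langle \mathcal{P},T\rangle$ where $T$ is a tree (the host tree) and $\mathcal{P}=(P_v)_{v\in V(G)}$ is a family of subpaths of $T$ such that distinct $v,w$ are adjacent in $G$ iff $E(P_v)\cap E(P_w)\neq\emptyset$. If the maximum degree of $T$ is $h$, it is an $(h,2,2)$-representation. It is Helly if the family $(E(P_v))_{v\in V(G)}$ has the Helly property (every pairwise intersecting subfamily has nonempty total intersection). Helly $[h,2,2]$ is the class of graphs admitting a Helly $(h,2,2)$-representation. -}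

module Defs where

open import Data.Nat using (ℕ; zero; suc; _+_; _∸_; _≤_; _≡ᵇ_)
open import Data.Bool using (Bool; true; false; _∧_; _∨_)
open import Data.Fin using (Fin; toℕ; splitAt)
open import Data.Fin.Subset using (Subset; _∈_; _∉_; _⊆_; ∣_∣)
open import Data.Vec using (lookup; tabulate)
open import Data.List using (List; []; _∷_)
open import Data.List.Relation.Unary.Unique.Propositional using (Unique)
open import Data.Sum using (_⊎_; inj₁; inj₂)
open import Data.Product using (Σ; _×_; _,_; ∃; ∃-syntax)
open import Function.Bundles using (_↔_; Inverse; _⇔_)
open import Function.Definitions using (Injective)
open import Relation.Binary.PropositionalEquality using (_≡_; _≢_)
open import Relation.Nullary using (¬_)
open import Data.Empty using (⊥)

Graph : ℕ → Set
Graph n = Fin n → Fin n → Bool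

Adj : ∀ {n} → Graph n → Fin n → Fin n → Set
Adj G i j = G i j ≡ true

IsSimple : ∀ {n} → Graph n → Set
IsSimple G = (∀ i j → G i j ≡ G j i) × (∀ i → G i i ≡ false)

record Iso {n m : ℕ} (G : Graph n) (H : Graph m) : Set where
  field
    bij      : Fin n ↔ Fin m
    preserve : ∀ i j → H (Inverse.to bij i) (Inverse.to bij j) ≡ G i j

PairwiseAdj : ∀ {n} → Graph n → Subset n → Set
PairwiseAdj G C = ∀ x y → x ∈ C → y ∈ C → x ≢ y → Adj G x y

IsClique : ∀ {n} → Graph n → Subset n → Set
IsClique G C = PairwiseAdj G C × (∀ D → PairwiseAdj G D → C ⊆ D → D ⊆ C)

HasExactlyCliques : ∀ {n} → Graph n → ℕ → Set
HasExactlyCliques {n} G k =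
  Σ (Fin k → Subset n) λ cl →
    Injective _≡_ _≡_ cl
    × (∀ i → IsClique G (cl i))
    × (∀ C → IsClique G C → ∃[ i ] cl i ≡ C)

pathAdj : ∀ {l} → Fin l → Fin l → Bool
pathAdj p q = (suc (toℕ p) ≡ᵇ toℕ q) ∨ (suc (toℕ q) ≡ᵇ toℕ p)

cycleGraph : (n : ℕ) → Graph n
cycleGraph n i j =
  pathAdj i j
  ∨ ((toℕ i ≡ᵇ 0) ∧ (suc (toℕ j) ≡ᵇ n))
  ∨ ((toℕ j ≡ᵇ 0) ∧ (suc (toℕ i) ≡ᵇ n))

-- extension of G by a chordless path v_1 … v_l (indices 0 … l-1),
-- v_1 joined to all of C, v_l joined to all of C'.
-- Old vertices occupy the first n positions of Fin (n + l).
extend : ∀ {n} → Graph n → Subset n → Subset n → (l : ℕ) → Graph (n + l)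
extend {n} G C C' l x y = go (splitAt n x) (splitAt n y)
  where
  attach : Fin l → Fin n → Bool
  attach p i = ((toℕ p ≡ᵇ 0) ∧ lookup C i) ∨ ((suc (toℕ p) ≡ᵇ l) ∧ lookup C' i)
  go : Fin n ⊎ Fin l → Fin n ⊎ Fin l → Bool
  go (inj₁ i) (inj₁ j) = G i j
  go (inj₁ i) (inj₂ p) = attach p i
  go (inj₂ p) (inj₁ i) = attach p i
  go (inj₂ p) (inj₂ q) = pathAdj p q

Disjoint : ∀ {n} → Subset n → Subset n → Set
Disjoint C C' = ∀ x → x ∈ C → x ∉ C'

data IsGate : (n : ℕ) → Graph n → Set where
  cycle  : ∀ n → 4 ≤ n → IsGate n (cycleGraph n)
  ext    : ∀ {n} {G : Graph n} → IsGate n G →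
           (C C' : Subset n) → IsClique G C → IsClique G C' → Disjoint C C' →
           (l : ℕ) → 2 ≤ l → IsGate (n + l) (extend G C C' l)
  iso    : ∀ {n m} {G : Graph n} {H : Graph m} → IsGate n G → Iso G H → IsGate m H

IsKGate : ℕ → ∀ {n} → Graph n → Set
IsKGate k {n} G = IsGate n G × HasExactlyCliques G k

data Walk {t} (T : Graph t) : Fin t → Fin t → Set where
  here  : ∀ u → Walk T u u
  step  : ∀ {u w v} → Adj T u w → Walk T w v → Walk T u v

Connected : ∀ {t} → Graph t → Set
Connected T = ∀ u v → Walk T u v

data Chain {t} (T : Graph t) : List (Fin t) → Set where
  one  : ∀ x → Chain T (x ∷ [])
  cons : ∀ {x y rest} → Adj T x y → Chain T (y ∷ rest) → Chain T (x ∷ y ∷ rest)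

last : ∀ {A : Set} → A → List A → A
last a []       = a
last a (b ∷ bs) = last b bs

IsCycle : ∀ {t} → Graph t → List (Fin t) → Set
IsCycle T [] = ⊥
IsCycle T (x ∷ []) = ⊥
IsCycle T (x ∷ y ∷ []) = ⊥
IsCycle T (x ∷ y ∷ z ∷ rest) =
  Unique (x ∷ y ∷ z ∷ rest) × Chain T (x ∷ y ∷ z ∷ rest) × Adj T (last z rest) x

Acyclic : ∀ {t} → Graph t → Set
Acyclic T = ∀ xs → ¬ IsCycle T xs

IsTree : ∀ {t} → Graph t → Set
IsTree T = IsSimple T × Connected T × Acyclic T

degree : ∀ {t} → Graph t → Fin t → ℕ
degree T i = ∣ tabulate (T i) ∣

MaxDegree : ∀ {t} → Graph t → ℕ → Set
MaxDegree T h = (∃[ i ] degree T i ≡ h) × (∀ i → degree T i ≤ h)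

IsStar : ∀ {t} → Graph t → Set
IsStar {t} T = IsSimple T × ∃[ c ] (∀ i j → Adj T i j ⇔ (i ≢ j × (i ≡ c ⊎ j ≡ c)))

IsPath : ∀ {t} → Graph t → List (Fin t) → Set
IsPath T xs = Unique xs × Chain T xs

data PathEdge {t} : List (Fin t) → Fin t → Fin t → Set where
  fwd  : ∀ {x y rest} → PathEdge (x ∷ y ∷ rest) x y
  bwd  : ∀ {x y rest} → PathEdge (x ∷ y ∷ rest) y x
  there : ∀ {x rest a b} → PathEdge rest a b → PathEdge (x ∷ rest) a b

EdgesMeet : ∀ {t} → List (Fin t) → List (Fin t) → Set
EdgesMeet P Q = ∃[ a ] ∃[ b ] (PathEdge P a b × PathEdge Q a b)

record EPTRep {n} (G : Graph n) : Set where
  field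
    t     : ℕ
    T     : Graph t
    tree  : IsTree T
    P     : Fin n → List (Fin t)
    paths : ∀ v → IsPath T (P v)
    rep   : ∀ v w → v ≢ w → (Adj G v w ⇔ EdgesMeet (P v) (P w))

IsHelly : ∀ {n} {G : Graph n} → EPTRep G → Set
IsHelly {n} R =
  ∀ (S : Subset n) → (∃[ v ] v ∈ S) →
  (∀ v w → v ∈ S → w ∈ S → EdgesMeet (P v) (P w)) →
  ∃[ a ] ∃[ b ] (∀ v → v ∈ S → PathEdge (P v) a b)
  where open EPTRep R

IsH22 : ∀ {n} {G : Graph n} → ℕ → EPTRep G → Set
IsH22 h R = MaxDegree (EPTRep.T R) h

HellyH22 : ℕ → ∀ {n} → Graph n → Set
HellyH22 h G = ∃[ R ] (IsH22 h R × IsHelly {G = G} R)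

-- In a gate every vertex neighbourhood is a disjoint union of at most two cliques. This holds
-- vacuously in a chordless cycle, and it survives attaching a path v₁ … v_l to disjoint cliques
-- C, C′: an interior path vertex has two non-adjacent neighbours, v₁ sees the clique C and v₂, and
-- an old vertex i ∈ C gains the single neighbour v₁, which joins the clique C ∖ {i} of N(i).
-- Hence every edge lies in exactly one clique and every vertex in one or two. Take the star K₁,ₖ
-- with one leaf per clique and represent a vertex by the path through the centre joining the
-- leaves of its cliques: two paths share an edge iff the vertices share a clique, i.e. are
-- adjacent, and a pairwise intersecting family is a clique, contained in a maximal clique whose
-- leaf edge lies on all of its paths.

module Submission where

open import Defs
open import Data.Nat using (ℕ; zero; suc; _≤_; _<_; _≡ᵇ_; _<ᵇ_; z≤n; s≤s)
open import Data.Nat.Properties as ℕ using (≡ᵇ⇒≡; ≡⇒≡ᵇ; <ᵇ⇒<; <⇒<ᵇ; suc-injective)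
open import Data.Bool using (Bool; true; false; _∧_; _∨_)
open import Data.Bool.Properties using (T-≡; ∨-comm; ∨-zeroʳ; ¬-not) renaming (_≟_ to _≟𝔹_)
open import Data.Fin as Fin using (Fin; toℕ; splitAt)
import Data.Fin.Properties as FinP
open import Data.Fin.Properties using (toℕ-injective; toℕ<n; +↔⊎; any?; _≟_)
open import Data.Fin.Subset using (Subset; _∈_; _∉_; _⊆_; ⁅_⁆; ∣_∣)
open import Data.Fin.Subset.Properties using (⊆-refl; ⊆-antisym; _∈?_; x∈⁅x⁆; x∈⁅y⁆⇒x≡y)
open import Data.Vec using (lookup; tabulate)
open import Data.Vec.Properties using (lookup∘tabulate; []=⇒lookup; lookup⇒[]=)
open import Data.List using (List; []; _∷_)
open import Data.List.Relation.Unary.All using ([]; _∷_)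
open import Data.List.Relation.Unary.AllPairs using ([]; _∷_)
open import Data.Sum as Sum using (_⊎_; inj₁; inj₂)
open import Data.Product using (_×_; _,_; proj₁; proj₂; ∃-syntax)
open import Data.Empty using (⊥-elim)
open import Function using (_∘_)
open import Function.Bundles using (Inverse; Injection; _⇔_; mk⇔; Equivalence)
open import Function.Properties.Equivalence using () renaming (trans to ⇔-trans; sym to ⇔-sym)
open import Function.Properties.Inverse using (↔-sym; Inverse⇒Injection)
open import Relation.Binary.PropositionalEquality
open import Relation.Nullary using (¬_; Dec; yes; no; does)
open import Relation.Nullary.Decidable using (decidable-stable; _⊎-dec_; _×-dec_; ¬?)
open import Relation.Unary using (Decidable)

open Equivalence using (to; from)

∨≡true⇒ : ∀ a {b} → a ∨ b ≡ true → a ≡ true ⊎ b ≡ true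
∨≡true⇒ true  _ = inj₁ refl
∨≡true⇒ false e = inj₂ e

∧≡true⇒ : ∀ a {b} → a ∧ b ≡ true → a ≡ true × b ≡ true
∧≡true⇒ true e = refl , e

≡ᵇ-sound : ∀ {m n} → (m ≡ᵇ n) ≡ true → m ≡ n
≡ᵇ-sound {m} {n} e = ≡ᵇ⇒≡ m n (from T-≡ e)

≡ᵇ-complete : ∀ {m n} → m ≡ n → (m ≡ᵇ n) ≡ true
≡ᵇ-complete {m} {n} e = to T-≡ (≡⇒≡ᵇ m n e)

<ᵇ-sound : ∀ {m n} → (m <ᵇ n) ≡ true → m < n
<ᵇ-sound {m} {n} e = <ᵇ⇒< m n (from T-≡ e)

<ᵇ-complete : ∀ {m n} → m < n → (m <ᵇ n) ≡ true
<ᵇ-complete m<n = to T-≡ (<⇒<ᵇ m<n)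

does-true⇔ : ∀ {A : Set} (a? : Dec A) → A ⇔ does a? ≡ true
does-true⇔ (yes a) = mk⇔ (λ _ → refl) (λ _ → a)
does-true⇔ (no ¬a) = mk⇔ (λ a → ⊥-elim (¬a a)) (λ ())

pigeonhole : ∀ (a b c : Bool) → a ≡ b ⊎ b ≡ c ⊎ a ≡ c
pigeonhole true  true  _     = inj₁ refl
pigeonhole false false _     = inj₁ refl
pigeonhole true  false true  = inj₂ (inj₂ refl)
pigeonhole true  false false = inj₂ (inj₁ refl)
pigeonhole false true  true  = inj₂ (inj₁ refl)
pigeonhole false true  false = inj₂ (inj₂ refl)

subsetOf : ∀ {n} {P : Fin n → Set} → Decidable P → Subset n
subsetOf P? = tabulate (λ x → does (P? x))

∈-subsetOf⁻ : ∀ {n} {P : Fin n → Set} (P? : Decidable P) {x} → x ∈ subsetOf P? → P x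
∈-subsetOf⁻ P? {x} x∈ = from (does-true⇔ (P? x)) (trans (sym (lookup∘tabulate _ x)) ([]=⇒lookup x∈))

∈-subsetOf⁺ : ∀ {n} {P : Fin n → Set} (P? : Decidable P) {x} → P x → x ∈ subsetOf P?
∈-subsetOf⁺ P? {x} p = lookup⇒[]= x _ (trans (lookup∘tabulate _ x) (to (does-true⇔ (P? x)) p))

-- Graphs whose neighbourhoods are unions of at most two cliques

Adjacent : {V : Set} → (V → V → Bool) → V → V → Set
Adjacent A x y = A x y ≡ true

ClusterTriple : {V : Set} → (V → V → Bool) → V → V → V → Set
ClusterTriple A x y z =
  (Adjacent A x y → Adjacent A y z → Adjacent A x z) ×
  (Adjacent A x y ⊎ Adjacent A y z ⊎ Adjacent A x z)

-- Quantified over all orderings, ClusterTriple says that a neighbourhood has neither an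
-- induced P₃ nor an independent triple, i.e. it is a disjoint union of at most two cliques.
record LocallyTwoCliques {V : Set} (A : V → V → Bool) : Set where
  field
    symmetric     : ∀ x y → A x y ≡ A y x
    irreflexive   : ∀ x → A x x ≡ false
    neighbourhood : ∀ v x y z → Adjacent A v x → Adjacent A v y → Adjacent A v z →
                    x ≢ y → y ≢ z → x ≢ z → ClusterTriple A x y z

  adjacent-sym : ∀ {x y} → Adjacent A x y → Adjacent A y x
  adjacent-sym {x} {y} xy = trans (symmetric y x) xy

  adjacent⇒≢ : ∀ {x y} → Adjacent A x y → x ≢ y
  adjacent⇒≢ {x} xx refl with trans (sym xx) (irreflexive x)
  ... | ()

locallyTwoCliques-pullback : ∀ {V W : Set} {A : V → V → Bool} {B : W → W → Bool} (f : W → V) →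
  (∀ {a b} → f a ≡ f b → a ≡ b) → (∀ a b → B a b ≡ A (f a) (f b)) →
  LocallyTwoCliques A → LocallyTwoCliques B
locallyTwoCliques-pullback {A = A} {B} f f-inj B≡A loc = record
  { symmetric     = λ a b → trans (B≡A a b) (trans (symmetric (f a) (f b)) (sym (B≡A b a)))
  ; irreflexive   = λ a → trans (B≡A a a) (irreflexive (f a))
  ; neighbourhood = λ v x y z vx vy vz x≢y y≢z x≢z →
      triple (neighbourhood (f v) (f x) (f y) (f z) (push vx) (push vy) (push vz)
                            (x≢y ∘ f-inj) (y≢z ∘ f-inj) (x≢z ∘ f-inj))
  }
  where
  open LocallyTwoCliques loc
  push : ∀ {a b} → Adjacent B a b → Adjacent A (f a) (f b)
  push {a} {b} e = trans (sym (B≡A a b)) e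
  pull : ∀ {a b} → Adjacent A (f a) (f b) → Adjacent B a b
  pull {a} {b} e = trans (B≡A a b) e
  triple : ∀ {x y z} → ClusterTriple A (f x) (f y) (f z) → ClusterTriple B x y z
  triple (transitive , edge) =
    (λ xy yz → pull (transitive (push xy) (push yz))) , Sum.map pull (Sum.map pull pull) edge

SplitBy : {V : Set} → (V → V → Bool) → (V → Bool) → V → V → Set
SplitBy A colour x y = Adjacent A x y ⇔ colour x ≡ colour y

splitBy-sym : ∀ {V} {A : V → V → Bool} {colour x y} → (∀ a b → A a b ≡ A b a) →
  SplitBy A colour x y → SplitBy A colour y x
splitBy-sym {x = x} {y} A-sym s =
  mk⇔ (λ yx → sym (to s (trans (A-sym x y) yx))) (λ c → trans (A-sym y x) (from s (sym c)))

SplitNeighbourhood : {V : Set} → (V → V → Bool) → V → (V → Bool) → Set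
SplitNeighbourhood A v colour =
  ∀ {x y} → Adjacent A v x → Adjacent A v y → x ≢ y → SplitBy A colour x y

splitNeighbourhood⇒clusterTriple : ∀ {V} (A : V → V → Bool) v colour →
  SplitNeighbourhood A v colour → ∀ {x y z} → Adjacent A v x → Adjacent A v y → Adjacent A v z →
  x ≢ y → y ≢ z → x ≢ z → ClusterTriple A x y z
splitNeighbourhood⇒clusterTriple A v colour split {x} {y} {z} vx vy vz x≢y y≢z x≢z =
  (λ xy yz → from sxz (trans (to sxy xy) (to syz yz))) ,
  edge (pigeonhole (colour x) (colour y) (colour z))
  where
  sxy : SplitBy A colour x y
  sxy = split vx vy x≢y
  syz : SplitBy A colour y z
  syz = split vy vz y≢z
  sxz : SplitBy A colour x z
  sxz = split vx vz x≢z
  edge : colour x ≡ colour y ⊎ colour y ≡ colour z ⊎ colour x ≡ colour z →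
         Adjacent A x y ⊎ Adjacent A y z ⊎ Adjacent A x z
  edge (inj₁ e)        = inj₁ (from sxy e)
  edge (inj₂ (inj₁ e)) = inj₂ (inj₁ (from syz e))
  edge (inj₂ (inj₂ e)) = inj₂ (inj₂ (from sxz e))

-- Cliques of a graph with two-clique neighbourhoods

module Cliques {n} {G : Graph n} (loc : LocallyTwoCliques G) where
  open LocallyTwoCliques loc

  adjacent? : ∀ x y → Dec (Adj G x y)
  adjacent? x y = G x y ≟𝔹 true

  InCliqueOf : Fin n → Fin n → Fin n → Set
  InCliqueOf v x y = y ≡ v ⊎ (Adj G v y × (y ≡ x ⊎ Adj G y x))

  inCliqueOf? : ∀ v x → Decidable (InCliqueOf v x)
  inCliqueOf? v x y = (y ≟ v) ⊎-dec (adjacent? v y ×-dec ((y ≟ x) ⊎-dec adjacent? y x))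

  cliqueOf : Fin n → Fin n → Subset n
  cliqueOf v x = subsetOf (inCliqueOf? v x)

  ∈cliqueOf : ∀ {v x y} → InCliqueOf v x y → y ∈ cliqueOf v x
  ∈cliqueOf {v} {x} = ∈-subsetOf⁺ (inCliqueOf? v x)

  v∈cliqueOf : ∀ v x → v ∈ cliqueOf v x
  v∈cliqueOf v x = ∈cliqueOf (inj₁ refl)

  x∈cliqueOf : ∀ {v x} → Adj G v x → x ∈ cliqueOf v x
  x∈cliqueOf vx = ∈cliqueOf (inj₂ (vx , inj₁ refl))

  cliqueOf-pairwise : ∀ {v x} → Adj G v x → PairwiseAdj G (cliqueOf v x)
  cliqueOf-pairwise {v} {x} vx a b a∈ b∈ a≢b
    with ∈-subsetOf⁻ (inCliqueOf? v x) a∈ | ∈-subsetOf⁻ (inCliqueOf? v x) b∈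
  ... | inj₁ refl             | inj₁ refl             = ⊥-elim (a≢b refl)
  ... | inj₁ refl             | inj₂ (vb , _)         = vb
  ... | inj₂ (va , _)         | inj₁ refl             = adjacent-sym va
  ... | inj₂ (_ , inj₁ refl)  | inj₂ (_ , inj₁ refl)  = ⊥-elim (a≢b refl)
  ... | inj₂ (_ , inj₁ refl)  | inj₂ (_ , inj₂ bx)    = adjacent-sym bx
  ... | inj₂ (_ , inj₂ ax)    | inj₂ (_ , inj₁ refl)  = ax
  ... | inj₂ (va , inj₂ ax)   | inj₂ (vb , inj₂ bx)   =
    proj₁ (neighbourhood v a x b va vx vb (adjacent⇒≢ ax) (≢-sym (adjacent⇒≢ bx)) a≢b)
          ax (adjacent-sym bx)

  ⊆cliqueOf : ∀ {D v x} → PairwiseAdj G D → v ∈ D → x ∈ D → D ⊆ cliqueOf v x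
  ⊆cliqueOf {D} {v} {x} pw v∈D x∈D {y} y∈D with y ≟ v | y ≟ x
  ... | yes y≡v | _       = ∈cliqueOf (inj₁ y≡v)
  ... | no y≢v  | yes y≡x = ∈cliqueOf (inj₂ (pw v y v∈D y∈D (≢-sym y≢v) , inj₁ y≡x))
  ... | no y≢v  | no y≢x  =
    ∈cliqueOf (inj₂ (pw v y v∈D y∈D (≢-sym y≢v) , inj₂ (pw y x y∈D x∈D y≢x)))

  cliqueOf-isClique : ∀ {v x} → Adj G v x → IsClique G (cliqueOf v x)
  cliqueOf-isClique {v} vx =
    cliqueOf-pairwise vx , λ D pw sub → ⊆cliqueOf pw (sub (v∈cliqueOf v _)) (sub (x∈cliqueOf vx))

  clique≡cliqueOf : ∀ {D v x} → IsClique G D → v ∈ D → x ∈ D → x ≢ v → D ≡ cliqueOf v x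
  clique≡cliqueOf {D} {v} {x} (pw , max) v∈D x∈D x≢v =
    ⊆-antisym D⊆ (max _ (cliqueOf-pairwise (pw v x v∈D x∈D (≢-sym x≢v))) D⊆)
    where
    D⊆ : D ⊆ cliqueOf v x
    D⊆ = ⊆cliqueOf pw v∈D x∈D

  singleton-or-other : (D : Subset n) (v : Fin n) → (∀ {y} → y ∈ D → y ≡ v) ⊎ ∃[ x ] (x ∈ D × x ≢ v)
  singleton-or-other D v with any? (λ x → (x ∈? D) ×-dec ¬? (x ≟ v))
  ... | yes other = inj₂ other
  ... | no ¬other = inj₁ λ {y} y∈D → decidable-stable (y ≟ v) (λ y≢v → ¬other (y , y∈D , y≢v))

  singletonClique≡ : ∀ {D D′ v} → IsClique G D → (∀ {y} → y ∈ D → y ≡ v) →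
                     IsClique G D′ → v ∈ D′ → D ≡ D′
  singletonClique≡ {D} {D′} (_ , max) only (pw′ , _) v∈D′ = ⊆-antisym D⊆D′ (max D′ pw′ D⊆D′)
    where
    D⊆D′ : D ⊆ D′
    D⊆D′ y∈D = subst (_∈ D′) (sym (only y∈D)) v∈D′

  clique-through : ∀ v → ∃[ D ] (IsClique G D × v ∈ D)
  clique-through v with any? (adjacent? v)
  ... | yes (x , vx) = cliqueOf v x , cliqueOf-isClique vx , v∈cliqueOf v x
  ... | no isolated  = ⁅ v ⁆ , (pairwise , maximal) , x∈⁅x⁆ v
    where
    pairwise : PairwiseAdj G ⁅ v ⁆
    pairwise a b a∈ b∈ a≢b = ⊥-elim (a≢b (trans (x∈⁅y⁆⇒x≡y v a∈) (sym (x∈⁅y⁆⇒x≡y v b∈))))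
    maximal : ∀ E → PairwiseAdj G E → ⁅ v ⁆ ⊆ E → E ⊆ ⁅ v ⁆
    maximal E pw sub {y} y∈E = subst (_∈ ⁅ v ⁆) (sym y≡v) (x∈⁅x⁆ v)
      where
      y≡v : y ≡ v
      y≡v = decidable-stable (y ≟ v) λ y≢v → isolated (y , pw v y (sub (x∈⁅x⁆ v)) y∈E (≢-sym y≢v))

  pairwise⊆clique : ∀ {S v} → PairwiseAdj G S → v ∈ S → ∃[ D ] (IsClique G D × S ⊆ D)
  pairwise⊆clique {S} {v} pw v∈S with singleton-or-other S v
  ... | inj₁ only =
    let (D , cD , v∈D) = clique-through v in D , cD , λ y∈S → subst (_∈ D) (sym (only y∈S)) v∈D
  ... | inj₂ (x , x∈S , x≢v) =
    cliqueOf v x , cliqueOf-isClique (pw v x v∈S x∈S (≢-sym x≢v)) , ⊆cliqueOf pw v∈S x∈S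

  cliques-linked : ∀ {D₁ D₂ v x₁ x₂} → IsClique G D₁ → IsClique G D₂ → v ∈ D₁ → v ∈ D₂ →
    x₁ ∈ D₁ → x₁ ≢ v → x₂ ∈ D₂ → x₂ ≢ v → x₁ ≡ x₂ ⊎ Adj G x₁ x₂ → D₁ ≡ D₂
  cliques-linked {D₂ = D₂} {v = v} {x₁} c₁ c₂ v∈D₁ v∈D₂ x₁∈D₁ x₁≢v x₂∈D₂ x₂≢v x₁≈x₂ =
    trans (clique≡cliqueOf c₁ v∈D₁ x₁∈D₁ x₁≢v) (sym (clique≡cliqueOf c₂ v∈D₂ x₁∈D₂ x₁≢v))
    where
    x₁∈D₂ : x₁ ∈ D₂
    x₁∈D₂ = subst (x₁ ∈_) (sym (clique≡cliqueOf c₂ v∈D₂ x₂∈D₂ x₂≢v))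
                  (∈cliqueOf (inj₂ (proj₁ c₁ v x₁ v∈D₁ x₁∈D₁ (≢-sym x₁≢v) , x₁≈x₂)))

  neighbours-pigeonhole : ∀ {v x₁ x₂ x₃} → Adj G v x₁ → Adj G v x₂ → Adj G v x₃ →
    (x₁ ≡ x₂ ⊎ Adj G x₁ x₂) ⊎ (x₂ ≡ x₃ ⊎ Adj G x₂ x₃) ⊎ (x₁ ≡ x₃ ⊎ Adj G x₁ x₃)
  neighbours-pigeonhole {v} {x₁} {x₂} {x₃} vx₁ vx₂ vx₃ with x₁ ≟ x₂ | x₂ ≟ x₃ | x₁ ≟ x₃
  ... | yes e | _     | _     = inj₁ (inj₁ e)
  ... | no _  | yes e | _     = inj₂ (inj₁ (inj₁ e))
  ... | no _  | no _  | yes e = inj₂ (inj₂ (inj₁ e))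
  ... | no ≢₁₂ | no ≢₂₃ | no ≢₁₃ =
    Sum.map inj₂ (Sum.map inj₂ inj₂) (proj₂ (neighbourhood v x₁ x₂ x₃ vx₁ vx₂ vx₃ ≢₁₂ ≢₂₃ ≢₁₃))

  at-most-two-cliques : ∀ {D₁ D₂ D₃ v} → IsClique G D₁ → IsClique G D₂ → IsClique G D₃ →
    v ∈ D₁ → v ∈ D₂ → v ∈ D₃ → D₁ ≡ D₂ ⊎ D₂ ≡ D₃ ⊎ D₁ ≡ D₃
  at-most-two-cliques {D₁} {D₂} {D₃} {v} c₁ c₂ c₃ v₁ v₂ v₃
    with singleton-or-other D₁ v | singleton-or-other D₂ v | singleton-or-other D₃ v
  ... | inj₁ only | _         | _         = inj₁ (singletonClique≡ c₁ only c₂ v₂)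
  ... | inj₂ _    | inj₁ only | _         = inj₁ (sym (singletonClique≡ c₂ only c₁ v₁))
  ... | inj₂ _    | inj₂ _    | inj₁ only = inj₂ (inj₁ (sym (singletonClique≡ c₃ only c₂ v₂)))
  ... | inj₂ (x₁ , x₁∈ , x₁≢v) | inj₂ (x₂ , x₂∈ , x₂≢v) | inj₂ (x₃ , x₃∈ , x₃≢v) =
    Sum.map (cliques-linked c₁ c₂ v₁ v₂ x₁∈ x₁≢v x₂∈ x₂≢v)
            (Sum.map (cliques-linked c₂ c₃ v₂ v₃ x₂∈ x₂≢v x₃∈ x₃≢v)
                     (cliques-linked c₁ c₃ v₁ v₃ x₁∈ x₁≢v x₃∈ x₃≢v))
            (neighbours-pigeonhole (edge c₁ v₁ x₁∈ x₁≢v) (edge c₂ v₂ x₂∈ x₂≢v)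
                                   (edge c₃ v₃ x₃∈ x₃≢v))
    where
    edge : ∀ {D x} → IsClique G D → v ∈ D → x ∈ D → x ≢ v → Adj G v x
    edge (pw , _) v∈D x∈D x≢v = pw v _ v∈D x∈D (≢-sym x≢v)

  clique-closed : ∀ {K i a b} → IsClique G K → i ∈ K → a ∈ K →
    Adj G i a → Adj G i b → Adj G a b → b ∈ K
  clique-closed {b = b} cK i∈K a∈K ia ib ab =
    subst (b ∈_) (sym (clique≡cliqueOf cK i∈K a∈K (≢-sym (adjacent⇒≢ ia))))
          (∈cliqueOf (inj₂ (ib , inj₂ (adjacent-sym ab))))

  outside-clique-adjacent : ∀ {K i a b} → IsClique G K → i ∈ K →
    Adj G i a → Adj G i b → a ≢ b → a ∉ K → b ∉ K → Adj G a b
  outside-clique-adjacent {K} {i} {a} {b} cK i∈K ia ib a≢b a∉K b∉K with singleton-or-other K i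
  ... | inj₁ only = ⊥-elim (a∉K (subst (a ∈_) K≡ (x∈cliqueOf ia)))
    where
    K≡ : cliqueOf i a ≡ K
    K≡ = sym (singletonClique≡ cK only (cliqueOf-isClique ia) (v∈cliqueOf i a))
  ... | inj₂ (z , z∈K , z≢i) = some-edge (proj₂ (neighbourhood i a b z ia ib iz a≢b b≢z a≢z))
    where
    iz : Adj G i z
    iz = proj₁ cK i z i∈K z∈K (≢-sym z≢i)
    b≢z : b ≢ z
    b≢z refl = b∉K z∈K
    a≢z : a ≢ z
    a≢z refl = a∉K z∈K
    some-edge : Adj G a b ⊎ Adj G b z ⊎ Adj G a z → Adj G a b
    some-edge (inj₁ ab)        = ab
    some-edge (inj₂ (inj₁ bz)) = ⊥-elim (b∉K (clique-closed cK i∈K z∈K iz ib (adjacent-sym bz)))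
    some-edge (inj₂ (inj₂ az)) = ⊥-elim (a∉K (clique-closed cK i∈K z∈K iz ia (adjacent-sym az)))

  clique-splits-neighbourhood : ∀ {K i} → IsClique G K → i ∈ K →
    SplitNeighbourhood G i (λ y → does (y ∈? K))
  clique-splits-neighbourhood {K} {i} cK i∈K {a} {b} ia ib a≢b with a ∈? K | b ∈? K
  ... | yes a∈K | yes b∈K = mk⇔ (λ _ → refl) (λ _ → proj₁ cK a b a∈K b∈K a≢b)
  ... | yes a∈K | no b∉K  =
    mk⇔ (λ ab → ⊥-elim (b∉K (clique-closed cK i∈K a∈K ia ib ab))) (λ ())
  ... | no a∉K  | yes b∈K =
    mk⇔ (λ ab → ⊥-elim (a∉K (clique-closed cK i∈K b∈K ib ia (adjacent-sym ab)))) (λ ())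
  ... | no a∉K  | no b∉K  =
    mk⇔ (λ _ → refl) (λ _ → outside-clique-adjacent cK i∈K ia ib a≢b a∉K b∉K)

Consecutive : ℕ → ℕ → Set
Consecutive p q = suc p ≡ q ⊎ suc q ≡ p

pathAdj⇒consecutive : ∀ {l} {p q : Fin l} → pathAdj p q ≡ true → Consecutive (toℕ p) (toℕ q)
pathAdj⇒consecutive {p = p} {q} pq = Sum.map ≡ᵇ-sound ≡ᵇ-sound (∨≡true⇒ (suc (toℕ p) ≡ᵇ toℕ q) pq)

consecutive-irrefl : ∀ p → ¬ Consecutive p p
consecutive-irrefl p (inj₁ e) = ℕ.1+n≢n e
consecutive-irrefl p (inj₂ e) = ℕ.1+n≢n e

pathAdj-sym : ∀ {l} (p q : Fin l) → pathAdj p q ≡ pathAdj q p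
pathAdj-sym p q = ∨-comm (suc (toℕ p) ≡ᵇ toℕ q) _

pathAdj-irrefl : ∀ {l} (p : Fin l) → pathAdj p p ≡ false
pathAdj-irrefl p = ¬-not (consecutive-irrefl (toℕ p) ∘ pathAdj⇒consecutive)

¬consecutive-neighbours : ∀ {p q r} → Consecutive p q → Consecutive p r → q ≢ r → ¬ Consecutive q r
¬consecutive-neighbours (inj₁ p→q) (inj₁ p→r) q≢r _ = q≢r (trans (sym p→q) p→r)
¬consecutive-neighbours (inj₂ q→p) (inj₂ r→p) q≢r _ = q≢r (suc-injective (trans q→p (sym r→p)))
¬consecutive-neighbours {r = r} (inj₁ refl) (inj₂ refl) _ (inj₁ e) = ℕ.m≢1+n+m r {2} (sym e)
¬consecutive-neighbours (inj₁ refl) (inj₂ refl) _ (inj₂ e) = ℕ.1+n≢n (sym e)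
¬consecutive-neighbours (inj₂ refl) (inj₁ refl) _ (inj₁ e) = ℕ.1+n≢n (sym e)
¬consecutive-neighbours {q = q} (inj₂ refl) (inj₁ refl) _ (inj₂ e) = ℕ.m≢1+n+m q {2} (sym e)

<ᵇ-≢ : ∀ {p q r} → ¬ q < p → r < p → (q <ᵇ p) ≢ (r <ᵇ p)
<ᵇ-≢ q≮p r<p e = q≮p (<ᵇ-sound (trans e (<ᵇ-complete r<p)))

consecutive-before≢ : ∀ {p q r} → Consecutive p q → Consecutive p r → q ≢ r → (q <ᵇ p) ≢ (r <ᵇ p)
consecutive-before≢ (inj₁ p→q) (inj₁ p→r) q≢r _ = q≢r (trans (sym p→q) p→r)
consecutive-before≢ (inj₂ q→p) (inj₂ r→p) q≢r _ = q≢r (suc-injective (trans q→p (sym r→p)))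
consecutive-before≢ (inj₁ p→q) (inj₂ r→p) _ =
  <ᵇ-≢ (ℕ.<-asym (ℕ.≤-reflexive p→q)) (ℕ.≤-reflexive r→p)
consecutive-before≢ (inj₂ q→p) (inj₁ p→r) _ =
  ≢-sym (<ᵇ-≢ (ℕ.<-asym (ℕ.≤-reflexive p→r)) (ℕ.≤-reflexive q→p))

-- Chordless cycles

Successor : ℕ → ℕ → ℕ → Set
Successor n v x = suc v ≡ x ⊎ (x ≡ 0 × suc v ≡ n)

CycleNeighbour : ∀ n → Fin n → Fin n → Set
CycleNeighbour n v x = Successor n (toℕ v) (toℕ x) ⊎ Successor n (toℕ x) (toℕ v)

cycle-neighbour : ∀ {n} {v x : Fin n} → Adj (cycleGraph n) v x → CycleNeighbour n v x
cycle-neighbour {n} {v} {x} vx with ∨≡true⇒ (pathAdj v x) vx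
... | inj₁ path = Sum.map inj₁ inj₁ (pathAdj⇒consecutive path)
... | inj₂ wrap with ∨≡true⇒ ((toℕ v ≡ᵇ 0) ∧ (suc (toℕ x) ≡ᵇ n)) wrap
... | inj₁ x→v = let (v≡0 , x≡n-1) = ∧≡true⇒ (toℕ v ≡ᵇ 0) x→v in
                 inj₂ (inj₂ (≡ᵇ-sound v≡0 , ≡ᵇ-sound x≡n-1))
... | inj₂ v→x = let (x≡0 , v≡n-1) = ∧≡true⇒ (toℕ x ≡ᵇ 0) v→x in
                 inj₁ (inj₂ (≡ᵇ-sound x≡0 , ≡ᵇ-sound v≡n-1))

successor-unique : ∀ {n v} {x y : Fin n} → Successor n v (toℕ x) → Successor n v (toℕ y) → x ≡ y
successor-unique (inj₁ v→x) (inj₁ v→y) = toℕ-injective (trans (sym v→x) v→y)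
successor-unique {x = x} (inj₁ v→x) (inj₂ (_ , v≡n-1)) =
  ⊥-elim (ℕ.<-irrefl (trans (sym v→x) v≡n-1) (toℕ<n x))
successor-unique {y = y} (inj₂ (_ , v≡n-1)) (inj₁ v→y) =
  ⊥-elim (ℕ.<-irrefl (trans (sym v→y) v≡n-1) (toℕ<n y))
successor-unique (inj₂ (x≡0 , _)) (inj₂ (y≡0 , _)) = toℕ-injective (trans x≡0 (sym y≡0))

predecessor-unique : ∀ {n v} {x y : Fin n} → Successor n (toℕ x) v → Successor n (toℕ y) v → x ≡ y
predecessor-unique (inj₁ x→v) (inj₁ y→v) = toℕ-injective (suc-injective (trans x→v (sym y→v)))
predecessor-unique (inj₁ refl) (inj₂ (() , _))
predecessor-unique (inj₂ (() , _)) (inj₁ refl)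
predecessor-unique (inj₂ (_ , x≡n-1)) (inj₂ (_ , y≡n-1)) =
  toℕ-injective (suc-injective (trans x≡n-1 (sym y≡n-1)))

cycle-degree≤2 : ∀ {n} {v x y z : Fin n} → let A = cycleGraph n in
  Adj A v x → Adj A v y → Adj A v z → x ≡ y ⊎ y ≡ z ⊎ x ≡ z
cycle-degree≤2 {n} {v} {x} {y} {z} vx vy vz =
  sides (cycle-neighbour vx) (cycle-neighbour vy) (cycle-neighbour vz)
  where
  sides : CycleNeighbour n v x → CycleNeighbour n v y → CycleNeighbour n v z →
          x ≡ y ⊎ y ≡ z ⊎ x ≡ z
  sides (inj₁ v→x) (inj₁ v→y) _          = inj₁ (successor-unique v→x v→y)
  sides (inj₂ x→v) (inj₂ y→v) _          = inj₁ (predecessor-unique x→v y→v)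
  sides (inj₁ v→x) (inj₂ y→v) (inj₁ v→z) = inj₂ (inj₂ (successor-unique v→x v→z))
  sides (inj₁ v→x) (inj₂ y→v) (inj₂ z→v) = inj₂ (inj₁ (predecessor-unique y→v z→v))
  sides (inj₂ x→v) (inj₁ v→y) (inj₁ v→z) = inj₂ (inj₁ (successor-unique v→y v→z))
  sides (inj₂ x→v) (inj₁ v→y) (inj₂ z→v) = inj₂ (inj₂ (predecessor-unique x→v z→v))

cycle-locallyTwoCliques : ∀ {n} → 1 < n → LocallyTwoCliques (cycleGraph n)
cycle-locallyTwoCliques {n} 1<n = record
  { symmetric     = λ i j →
      cong₂ _∨_ (pathAdj-sym i j) (∨-comm ((toℕ i ≡ᵇ 0) ∧ (suc (toℕ j) ≡ᵇ n)) _)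
  ; irreflexive   = λ i → ¬-not (no-loop {i} ∘ cycle-neighbour {v = i} {i})
  ; neighbourhood = λ v x y z vx vy vz x≢y y≢z x≢z →
      ⊥-elim (Sum.[ x≢y , Sum.[ y≢z , x≢z ] ] (cycle-degree≤2 vx vy vz))
  }
  where
  no-successor-loop : ∀ {i} → ¬ Successor n i i
  no-successor-loop (inj₁ i→i)        = ℕ.1+n≢n i→i
  no-successor-loop (inj₂ (refl , n≡1)) = ℕ.<-irrefl n≡1 1<n
  no-loop : ∀ {i : Fin n} → ¬ CycleNeighbour n i i
  no-loop (inj₁ i→i) = no-successor-loop i→i
  no-loop (inj₂ i→i) = no-successor-loop i→i

-- Attaching a path to two disjoint cliques

attach : ∀ {n} → Subset n → Subset n → (l : ℕ) → Fin l → Fin n → Bool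
attach C C′ l p i = ((toℕ p ≡ᵇ 0) ∧ lookup C i) ∨ ((suc (toℕ p) ≡ᵇ l) ∧ lookup C′ i)

extend⊎ : ∀ {n} → Graph n → Subset n → Subset n → (l : ℕ) → Fin n ⊎ Fin l → Fin n ⊎ Fin l → Bool
extend⊎ G C C′ l (inj₁ i) (inj₁ j) = G i j
extend⊎ G C C′ l (inj₁ i) (inj₂ p) = attach C C′ l p i
extend⊎ G C C′ l (inj₂ p) (inj₁ i) = attach C C′ l p i
extend⊎ G C C′ l (inj₂ p) (inj₂ q) = pathAdj p q

extend-splitAt : ∀ {n} (G : Graph n) C C′ l x y →
  extend G C C′ l x y ≡ extend⊎ G C C′ l (splitAt n x) (splitAt n y)
extend-splitAt {n} G C C′ l x y with splitAt n x | splitAt n y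
... | inj₁ _ | inj₁ _ = refl
... | inj₁ _ | inj₂ _ = refl
... | inj₂ _ | inj₁ _ = refl
... | inj₂ _ | inj₂ _ = refl

module Extension {n} {G : Graph n} (loc : LocallyTwoCliques G)
  {C C′ : Subset n} (cC : IsClique G C) (cC′ : IsClique G C′) (disjoint : Disjoint C C′)
  {l : ℕ} (2≤l : 2 ≤ l) where

  open LocallyTwoCliques loc
  open Cliques loc using (clique-splits-neighbourhood)

  H : Fin n ⊎ Fin l → Fin n ⊎ Fin l → Bool
  H = extend⊎ G C C′ l

  Attached : Fin l → Fin n → Set
  Attached p i = (toℕ p ≡ 0 × i ∈ C) ⊎ (suc (toℕ p) ≡ l × i ∈ C′)

  attach⇒Attached : ∀ {p i} → attach C C′ l p i ≡ true → Attached p i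
  attach⇒Attached {p} {i} pi with ∨≡true⇒ ((toℕ p ≡ᵇ 0) ∧ lookup C i) pi
  ... | inj₁ first = let (p≡0 , i∈C) = ∧≡true⇒ (toℕ p ≡ᵇ 0) first in
                     inj₁ (≡ᵇ-sound p≡0 , lookup⇒[]= i C i∈C)
  ... | inj₂ last  = let (p≡l-1 , i∈C′) = ∧≡true⇒ (suc (toℕ p) ≡ᵇ l) last in
                     inj₂ (≡ᵇ-sound p≡l-1 , lookup⇒[]= i C′ i∈C′)

  Attached⇒attach : ∀ {p i} → Attached p i → attach C C′ l p i ≡ true
  Attached⇒attach (inj₁ (p≡0 , i∈C)) rewrite ≡ᵇ-complete p≡0 | []=⇒lookup i∈C = refl
  Attached⇒attach (inj₂ (p≡l-1 , i∈C′)) rewrite ≡ᵇ-complete p≡l-1 | []=⇒lookup i∈C′ = ∨-zeroʳ _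

  first≢last : ∀ {p} → p ≡ 0 → suc p ≢ l
  first≢last refl refl = ℕ.<-irrefl refl 2≤l

  attached-unique : ∀ {p q i} → Attached p i → Attached q i → p ≡ q
  attached-unique (inj₁ (p≡0 , _)) (inj₁ (q≡0 , _)) = toℕ-injective (trans p≡0 (sym q≡0))
  attached-unique {i = i} (inj₁ (_ , i∈C)) (inj₂ (_ , i∈C′)) = ⊥-elim (disjoint i i∈C i∈C′)
  attached-unique {i = i} (inj₂ (_ , i∈C′)) (inj₁ (_ , i∈C)) = ⊥-elim (disjoint i i∈C i∈C′)
  attached-unique (inj₂ (p≡l-1 , _)) (inj₂ (q≡l-1 , _)) =
    toℕ-injective (suc-injective (trans p≡l-1 (sym q≡l-1)))

  attached-¬consecutive : ∀ {p q i} → Attached p i → Attached q i → ¬ Consecutive (toℕ p) (toℕ q)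
  attached-¬consecutive pi qi with attached-unique pi qi
  ... | refl = consecutive-irrefl _

  endClique : ∀ {p i} → Attached p i →
    ∃[ K ] (IsClique G K × i ∈ K × (∀ j → attach C C′ l p j ≡ true ⇔ j ∈ K))
  endClique {p} (inj₁ (p≡0 , i∈C)) =
    C , cC , i∈C , λ j → mk⇔ (inC ∘ attach⇒Attached) (λ j∈C → Attached⇒attach (inj₁ (p≡0 , j∈C)))
    where
    inC : ∀ {j} → Attached p j → j ∈ C
    inC (inj₁ (_ , j∈C))     = j∈C
    inC (inj₂ (p≡l-1 , _))   = ⊥-elim (first≢last p≡0 p≡l-1)
  endClique {p} (inj₂ (p≡l-1 , i∈C′)) =
    C′ , cC′ , i∈C′ ,
    λ j → mk⇔ (inC′ ∘ attach⇒Attached) (λ j∈C′ → Attached⇒attach (inj₂ (p≡l-1 , j∈C′)))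
    where
    inC′ : ∀ {j} → Attached p j → j ∈ C′
    inC′ (inj₁ (p≡0 , _))   = ⊥-elim (first≢last p≡0 p≡l-1)
    inC′ (inj₂ (_ , j∈C′))  = j∈C′

  attached-adjacent : ∀ {p a b} → Attached p a → Attached p b → a ≢ b → Adj G a b
  attached-adjacent {b = b} pa pb a≢b =
    let (K , (pairwise , _) , a∈K , attach⇔K) = endClique pa in
    pairwise _ b a∈K (to (attach⇔K b) (Attached⇒attach pb)) a≢b

  H-symmetric : ∀ x y → H x y ≡ H y x
  H-symmetric (inj₁ i) (inj₁ j) = symmetric i j
  H-symmetric (inj₁ i) (inj₂ q) = refl
  H-symmetric (inj₂ p) (inj₁ j) = refl
  H-symmetric (inj₂ p) (inj₂ q) = pathAdj-sym p q

  H-irreflexive : ∀ x → H x x ≡ false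
  H-irreflexive (inj₁ i) = irreflexive i
  H-irreflexive (inj₂ p) = pathAdj-irrefl p

  -- whether a neighbour of the path vertex p comes before p along C, v₁, …, v_l, C′
  before : Fin l → Fin n ⊎ Fin l → Bool
  before p (inj₁ _) = toℕ p ≡ᵇ 0
  before p (inj₂ q) = toℕ q <ᵇ toℕ p

  attached-before≢ : ∀ {p q i} → Attached p i → Consecutive (toℕ p) (toℕ q) →
    before p (inj₁ i) ≢ before p (inj₂ q)
  attached-before≢ (inj₁ (p≡0 , _)) _ rewrite p≡0 = λ ()
  attached-before≢ {q = q} (inj₂ (p≡l-1 , _)) (inj₁ p→q) _ =
    ℕ.<-irrefl (trans (sym p→q) p≡l-1) (toℕ<n q)
  attached-before≢ {p} {q} (inj₂ (p≡l-1 , _)) (inj₂ q→p) e =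
    first≢last (≡ᵇ-sound (trans e (<ᵇ-complete (ℕ.≤-reflexive q→p)))) p≡l-1

  pathVertex-split : ∀ p → SplitNeighbourhood H (inj₂ p) (before p)
  pathVertex-split p {inj₁ a} {inj₁ b} pa pb a≢b =
    mk⇔ (λ _ → refl)
        (λ _ → attached-adjacent (attach⇒Attached pa) (attach⇒Attached pb) (a≢b ∘ cong inj₁))
  pathVertex-split p {inj₁ a} {inj₂ q} pa pq _ =
    mk⇔ (λ aq → ⊥-elim (attached-¬consecutive (attach⇒Attached pa) (attach⇒Attached aq)
                                              (pathAdj⇒consecutive pq)))
        (λ e → ⊥-elim (attached-before≢ (attach⇒Attached pa) (pathAdj⇒consecutive pq) e))
  pathVertex-split p {inj₂ q} {inj₁ a} pq pa q≢a =
    splitBy-sym {colour = before p} {inj₁ a} {inj₂ q} H-symmetric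
                (pathVertex-split p {inj₁ a} {inj₂ q} pa pq (≢-sym q≢a))
  pathVertex-split p {inj₂ q} {inj₂ r} pq pr q≢r =
    mk⇔ (λ qr → ⊥-elim (¬consecutive-neighbours pq′ pr′ q≢r′ (pathAdj⇒consecutive qr)))
        (λ e → ⊥-elim (consecutive-before≢ pq′ pr′ q≢r′ e))
    where
    pq′ : Consecutive (toℕ p) (toℕ q)
    pq′ = pathAdj⇒consecutive pq
    pr′ : Consecutive (toℕ p) (toℕ r)
    pr′ = pathAdj⇒consecutive pr
    q≢r′ : toℕ q ≢ toℕ r
    q≢r′ = q≢r ∘ cong inj₂ ∘ toℕ-injective

  inK-or-new : Subset n → Fin n ⊎ Fin l → Bool
  inK-or-new K (inj₁ j) = does (j ∈? K)
  inK-or-new K (inj₂ _) = true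

  attachedVertex-split : ∀ {q i K} → Attached q i → IsClique G K → i ∈ K →
    (∀ j → attach C C′ l q j ≡ true ⇔ j ∈ K) → SplitNeighbourhood H (inj₁ i) (inK-or-new K)
  attachedVertex-split qi cK i∈K q⇔K {inj₁ a} {inj₁ b} ia ib a≢b =
    clique-splits-neighbourhood cK i∈K ia ib (a≢b ∘ cong inj₁)
  attachedVertex-split {K = K} qi cK i∈K q⇔K {inj₁ a} {inj₂ r} ia ir _
    with attached-unique (attach⇒Attached ir) qi
  ... | refl = ⇔-trans (q⇔K a) (does-true⇔ (a ∈? K))
  attachedVertex-split {K = K} qi cK i∈K q⇔K {inj₂ r} {inj₁ a} ir ia r≢a =
    splitBy-sym {colour = inK-or-new K} {inj₁ a} {inj₂ r} H-symmetric
                (attachedVertex-split qi cK i∈K q⇔K ia ir (≢-sym r≢a))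
  attachedVertex-split qi cK i∈K q⇔K {inj₂ r} {inj₂ r′} ir ir′ r≢r′ =
    ⊥-elim (r≢r′ (cong inj₂ (trans (attached-unique (attach⇒Attached ir) qi)
                                   (sym (attached-unique (attach⇒Attached ir′) qi)))))

  H-neighbourhood : ∀ v x y z → Adjacent H v x → Adjacent H v y → Adjacent H v z →
    x ≢ y → y ≢ z → x ≢ z → ClusterTriple H x y z
  H-neighbourhood (inj₂ p) x y z =
    splitNeighbourhood⇒clusterTriple H (inj₂ p) (before p) (pathVertex-split p)
  H-neighbourhood (inj₁ i) x y z ix iy iz x≢y y≢z x≢z with any? (λ q → attach C C′ l q i ≟𝔹 true)
  ... | yes (q , qi) =
    let (K , cK , i∈K , q⇔K) = endClique (attach⇒Attached qi) in
    splitNeighbourhood⇒clusterTriple H (inj₁ i) (inK-or-new K)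
      (attachedVertex-split (attach⇒Attached qi) cK i∈K q⇔K) ix iy iz x≢y y≢z x≢z
  ... | no unattached = oldTriple x y z ix iy iz x≢y y≢z x≢z
    where
    oldTriple : ∀ x y z → Adjacent H (inj₁ i) x → Adjacent H (inj₁ i) y → Adjacent H (inj₁ i) z →
      x ≢ y → y ≢ z → x ≢ z → ClusterTriple H x y z
    oldTriple (inj₁ a) (inj₁ b) (inj₁ c) ia ib ic a≢b b≢c a≢c =
      neighbourhood i a b c ia ib ic (a≢b ∘ cong inj₁) (b≢c ∘ cong inj₁) (a≢c ∘ cong inj₁)
    oldTriple (inj₂ q) _ _ iq _ _ _ _ _ = ⊥-elim (unattached (q , iq))
    oldTriple _ (inj₂ q) _ _ iq _ _ _ _ = ⊥-elim (unattached (q , iq))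
    oldTriple _ _ (inj₂ q) _ _ iq _ _ _ = ⊥-elim (unattached (q , iq))

  locallyTwoCliques : LocallyTwoCliques H
  locallyTwoCliques = record
    { symmetric = H-symmetric ; irreflexive = H-irreflexive ; neighbourhood = H-neighbourhood }

gate-locallyTwoCliques : ∀ {n} {G : Graph n} → IsGate n G → LocallyTwoCliques G
gate-locallyTwoCliques (cycle n 4≤n) = cycle-locallyTwoCliques (ℕ.≤-trans (s≤s (s≤s z≤n)) 4≤n)
gate-locallyTwoCliques (ext {n} {G} gate C C′ cC cC′ disjoint l 2≤l) =
  locallyTwoCliques-pullback (splitAt n) (Injection.injective (Inverse⇒Injection +↔⊎))
                             (extend-splitAt G C C′ l)
           (Extension.locallyTwoCliques (gate-locallyTwoCliques gate) cC cC′ disjoint 2≤l)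
gate-locallyTwoCliques {G = H} (iso {G = G} gate I) =
  locallyTwoCliques-pullback φ⁻¹ (Injection.injective (Inverse⇒Injection (↔-sym bij))) H≡G
                             (gate-locallyTwoCliques gate)
  where
  open Iso I
  open Inverse bij using () renaming (from to φ⁻¹; strictlyInverseˡ to φ∘φ⁻¹)
  H≡G : ∀ a b → H a b ≡ G (φ⁻¹ a) (φ⁻¹ b)
  H≡G a b = trans (sym (cong₂ H (φ∘φ⁻¹ a) (φ∘φ⁻¹ b))) (preserve (φ⁻¹ a) (φ⁻¹ b))

-- The star K₁,ₖ

star : (k : ℕ) → Graph (suc k)
star k Fin.zero    Fin.zero    = false
star k Fin.zero    (Fin.suc _) = true
star k (Fin.suc _) Fin.zero    = true
star k (Fin.suc _) (Fin.suc _) = false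

star-isSimple : ∀ k → IsSimple (star k)
star-isSimple k = symmetric , irreflexive
  where
  symmetric : ∀ i j → star k i j ≡ star k j i
  symmetric Fin.zero    Fin.zero    = refl
  symmetric Fin.zero    (Fin.suc _) = refl
  symmetric (Fin.suc _) Fin.zero    = refl
  symmetric (Fin.suc _) (Fin.suc _) = refl
  irreflexive : ∀ i → star k i i ≡ false
  irreflexive Fin.zero    = refl
  irreflexive (Fin.suc _) = refl

star-connected : ∀ k → Connected (star k)
star-connected k Fin.zero    Fin.zero    = here _
star-connected k Fin.zero    (Fin.suc _) = step refl (here _)
star-connected k (Fin.suc _) Fin.zero    = step refl (here _)
star-connected k (Fin.suc _) (Fin.suc _) = step {w = Fin.zero} refl (step refl (here _))

star-acyclic : ∀ k → Acyclic (star k)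
star-acyclic k (Fin.zero ∷ Fin.zero ∷ _ ∷ _) (_ , cons () _ , _)
star-acyclic k (Fin.suc _ ∷ Fin.suc _ ∷ _ ∷ _) (_ , cons () _ , _)
star-acyclic k (Fin.zero ∷ Fin.suc _ ∷ Fin.suc _ ∷ _) (_ , cons _ (cons () _) , _)
star-acyclic k (Fin.zero ∷ Fin.suc _ ∷ Fin.zero ∷ _) ((_ ∷ (x≢z ∷ _)) ∷ _ , _) = x≢z refl
star-acyclic k (Fin.suc _ ∷ Fin.zero ∷ Fin.zero ∷ _) (_ , cons _ (cons () _) , _)
star-acyclic k (Fin.suc _ ∷ Fin.zero ∷ Fin.suc _ ∷ []) (_ , _ , ())
star-acyclic k (Fin.suc _ ∷ Fin.zero ∷ Fin.suc _ ∷ Fin.suc _ ∷ _) (_ , cons _ (cons _ (cons () _)) , _)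
star-acyclic k (Fin.suc _ ∷ Fin.zero ∷ Fin.suc _ ∷ Fin.zero ∷ _) (_ ∷ ((_ ∷ (y≢w ∷ _)) ∷ _) , _) = y≢w refl

star-isTree : ∀ k → IsTree (star k)
star-isTree k = star-isSimple k , star-connected k , star-acyclic k

star-isStar : ∀ k → IsStar (star k)
star-isStar k = star-isSimple k , Fin.zero , adjacent⇔
  where
  adjacent⇔ : ∀ i j → Adj (star k) i j ⇔ (i ≢ j × (i ≡ Fin.zero ⊎ j ≡ Fin.zero))
  adjacent⇔ Fin.zero    Fin.zero    = mk⇔ (λ ()) (λ (i≢i , _) → ⊥-elim (i≢i refl))
  adjacent⇔ Fin.zero    (Fin.suc _) = mk⇔ (λ _ → (λ ()) , inj₁ refl) (λ _ → refl)
  adjacent⇔ (Fin.suc _) Fin.zero    = mk⇔ (λ _ → (λ ()) , inj₂ refl) (λ _ → refl)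
  adjacent⇔ (Fin.suc _) (Fin.suc _) = mk⇔ (λ ()) λ { (_ , inj₁ ()) ; (_ , inj₂ ()) }

∣tabulate-true∣ : ∀ m → ∣ tabulate {n = m} (λ _ → true) ∣ ≡ m
∣tabulate-true∣ zero    = refl
∣tabulate-true∣ (suc m) = cong suc (∣tabulate-true∣ m)

∣tabulate-false∣ : ∀ m → ∣ tabulate {n = m} (λ _ → false) ∣ ≡ 0
∣tabulate-false∣ zero    = refl
∣tabulate-false∣ (suc m) = ∣tabulate-false∣ m

star-degree≤ : ∀ k i → degree (star k) i ≤ k
star-degree≤ k       Fin.zero    = ℕ.≤-reflexive (∣tabulate-true∣ k)
star-degree≤ (suc k) (Fin.suc i) = s≤s (ℕ.≤-trans (ℕ.≤-reflexive (∣tabulate-false∣ (suc k))) z≤n)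

star-maxDegree : ∀ k → MaxDegree (star k) k
star-maxDegree k = (Fin.zero , ∣tabulate-true∣ k) , star-degree≤ k

-- The star representation

module StarRepresentation {n} {G : Graph n} (loc : LocallyTwoCliques G)
  {k} (cliques : HasExactlyCliques G k) where

  open Cliques loc

  clique : Fin k → Subset n
  clique = proj₁ cliques

  clique-injective : ∀ {a b} → clique a ≡ clique b → a ≡ b
  clique-injective = proj₁ (proj₂ cliques)

  clique-isClique : ∀ m → IsClique G (clique m)
  clique-isClique = proj₁ (proj₂ (proj₂ cliques))

  clique-index : ∀ D → IsClique G D → ∃[ m ] clique m ≡ D
  clique-index = proj₂ (proj₂ (proj₂ cliques))

  ⊆clique-index : ∀ {S D} → IsClique G D → S ⊆ D → ∃[ m ] S ⊆ clique m
  ⊆clique-index {D = D} cD S⊆D = let (m , m≡D) = clique-index D cD in m , subst (_ ⊆_) (sym m≡D) S⊆D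

  SameClique : Fin n → Fin n → Set
  SameClique v w = ∃[ m ] (v ∈ clique m × w ∈ clique m)

  sameClique⇒adjacent : ∀ {v w} → v ≢ w → SameClique v w → Adj G v w
  sameClique⇒adjacent v≢w (m , v∈ , w∈) = proj₁ (clique-isClique m) _ _ v∈ w∈ v≢w

  adjacent⇒sameClique : ∀ {v w} → Adj G v w → SameClique v w
  adjacent⇒sameClique {v} {w} vw =
    let (m , vw⊆) = ⊆clique-index (cliqueOf-isClique vw) ⊆-refl
    in m , vw⊆ (v∈cliqueOf v w) , vw⊆ (x∈cliqueOf vw)

  data CliqueIndices (v : Fin n) : Set where
    one : ∀ i → v ∈ clique i → (∀ m → v ∈ clique m → m ≡ i) → CliqueIndices v
    two : ∀ i j → j ≢ i → v ∈ clique i → v ∈ clique j →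
          (∀ m → v ∈ clique m → m ≡ i ⊎ m ≡ j) → CliqueIndices v

  cliqueIndices : ∀ v → CliqueIndices v
  cliqueIndices v with clique-through v
  ... | (D , cD , v∈D) with clique-index D cD
  ...   | (i , refl) with any? (λ j → (v ∈? clique j) ×-dec ¬? (j ≟ i))
  ...     | yes (j , v∈j , j≢i) = two i j j≢i v∈D v∈j onlyTwo
    where
    onlyTwo : ∀ m → v ∈ clique m → m ≡ i ⊎ m ≡ j
    onlyTwo m v∈m
      with at-most-two-cliques (clique-isClique i) (clique-isClique j) (clique-isClique m) v∈D v∈j v∈m
    ... | inj₁ i≡j         = ⊥-elim (j≢i (sym (clique-injective i≡j)))
    ... | inj₂ (inj₁ j≡m)  = inj₂ (sym (clique-injective j≡m))
    ... | inj₂ (inj₂ i≡m)  = inj₁ (sym (clique-injective i≡m))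
  ...     | no ¬other = one i v∈D λ m v∈m → decidable-stable (m ≟ i) (λ m≢i → ¬other (m , v∈m , m≢i))

  -- leaf suc m of the star stands for clique m
  pathOf : ∀ {v} → CliqueIndices v → List (Fin (suc k))
  pathOf (one i _ _)         = Fin.suc i ∷ Fin.zero ∷ []
  pathOf (two i j _ _ _ _)   = Fin.suc i ∷ Fin.zero ∷ Fin.suc j ∷ []

  pathOf-isPath : ∀ {v} (I : CliqueIndices v) → IsPath (star k) (pathOf I)
  pathOf-isPath (one _ _ _) = ((λ ()) ∷ []) ∷ [] ∷ [] , cons refl (one _)
  pathOf-isPath (two i j j≢i _ _ _) =
    ((λ ()) ∷ (λ e → j≢i (sym (FinP.suc-injective e))) ∷ []) ∷ ((λ ()) ∷ []) ∷ [] ∷ []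
    , cons refl (cons refl (one _))

  LeafEdge : Fin k → Fin (suc k) → Fin (suc k) → Set
  LeafEdge m a b = (a ≡ Fin.zero × b ≡ Fin.suc m) ⊎ (a ≡ Fin.suc m × b ≡ Fin.zero)

  leafEdge-injective : ∀ {m m′ a b} → LeafEdge m a b → LeafEdge m′ a b → m ≡ m′
  leafEdge-injective (inj₁ (refl , refl)) (inj₁ (_ , e))  = FinP.suc-injective e
  leafEdge-injective (inj₁ (refl , refl)) (inj₂ (() , _))
  leafEdge-injective (inj₂ (refl , refl)) (inj₁ (() , _))
  leafEdge-injective (inj₂ (refl , refl)) (inj₂ (e , _))  = FinP.suc-injective e

  pathOf-edge : ∀ {v a b} (I : CliqueIndices v) → PathEdge (pathOf I) a b →
    ∃[ m ] (v ∈ clique m × LeafEdge m a b)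
  pathOf-edge (one i v∈i _)             fwd         = i , v∈i , inj₂ (refl , refl)
  pathOf-edge (one i v∈i _)             bwd         = i , v∈i , inj₁ (refl , refl)
  pathOf-edge (one _ _ _)               (there (there ()))
  pathOf-edge (two i _ _ v∈i _ _)       fwd         = i , v∈i , inj₂ (refl , refl)
  pathOf-edge (two i _ _ v∈i _ _)       bwd         = i , v∈i , inj₁ (refl , refl)
  pathOf-edge (two _ j _ _ v∈j _)       (there fwd) = j , v∈j , inj₁ (refl , refl)
  pathOf-edge (two _ j _ _ v∈j _)       (there bwd) = j , v∈j , inj₂ (refl , refl)
  pathOf-edge (two _ _ _ _ _ _)         (there (there (there ())))

  pathOf-leafEdge : ∀ {v m} (I : CliqueIndices v) → v ∈ clique m →
    PathEdge (pathOf I) Fin.zero (Fin.suc m)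
  pathOf-leafEdge {m = m} (one _ _ only) v∈m rewrite only m v∈m = bwd
  pathOf-leafEdge {m = m} (two _ _ _ _ _ onlyTwo) v∈m with onlyTwo m v∈m
  ... | inj₁ refl = bwd
  ... | inj₂ refl = there fwd

  path : Fin n → List (Fin (suc k))
  path v = pathOf (cliqueIndices v)

  edgesMeet⇔sameClique : ∀ {v w} → EdgesMeet (path v) (path w) ⇔ SameClique v w
  edgesMeet⇔sameClique {v} {w} = mk⇔ sameClique meet
    where
    sameClique : EdgesMeet (path v) (path w) → SameClique v w
    sameClique (a , b , ab∈v , ab∈w) =
      let (m , v∈m , m-leaf) = pathOf-edge (cliqueIndices v) ab∈v
          (_ , w∈m′ , m′-leaf) = pathOf-edge (cliqueIndices w) ab∈w
      in m , v∈m , subst (λ m′ → w ∈ clique m′) (sym (leafEdge-injective m-leaf m′-leaf)) w∈m′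
    meet : SameClique v w → EdgesMeet (path v) (path w)
    meet (m , v∈m , w∈m) =
      Fin.zero , Fin.suc m ,
      pathOf-leafEdge (cliqueIndices v) v∈m , pathOf-leafEdge (cliqueIndices w) w∈m

  representation : EPTRep G
  representation = record
    { t     = suc k
    ; T     = star k
    ; tree  = star-isTree k
    ; P     = path
    ; paths = pathOf-isPath ∘ cliqueIndices
    ; rep   = λ v w v≢w → ⇔-trans (mk⇔ adjacent⇒sameClique (sameClique⇒adjacent v≢w))
                                   (⇔-sym edgesMeet⇔sameClique)
    }

  representation-isHelly : IsHelly representation
  representation-isHelly S (v , v∈S) meet =
    let (D , cD , S⊆D) = pairwise⊆clique pairwise v∈S
        (m , S⊆m)      = ⊆clique-index cD S⊆D
    in Fin.zero , Fin.suc m , λ w w∈S → pathOf-leafEdge (cliqueIndices w) (S⊆m w∈S)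
    where
    pairwise : PairwiseAdj G S
    pairwise x y x∈S y∈S x≢y = sameClique⇒adjacent x≢y (to edgesMeet⇔sameClique (meet x y x∈S y∈S))

lemma4 : (k : ℕ) → 4 ≤ k → (n : ℕ) → (G : Graph n) → IsKGate k G →
    HellyH22 k G
    × (∃[ R ] (IsH22 k R × IsHelly {G = G} R × IsStar (EPTRep.T R)))
lemma4 k _ n G (gate , cliques) =
  (representation , star-maxDegree k , representation-isHelly)
  , (representation , star-maxDegree k , representation-isHelly , star-isStar k)
  where
  open StarRepresentation (gate-locallyTwoCliques gate) cliques
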